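{- Let $n,t\ge 1$ be integers, suppose $\mathcal{A}\subseteq\mathcal{M}_n(t)$, and define the nonnegative real number $x$ by $|\mathcal{A}|=\left\langle {x \atop t}\right\rangle$. Then $|\partial\mathcal{A}|\ge \left\langle {x \atop t-1}\right\rangle$.
   Context: $\mathcal{M}_n(t)$ denotes the family of $t$-element multisets of $[n]=\{1,\ldots,n\}$. For real $x\ge 0$, $\left\langle {x \atop t}\right\rangle = x(x+1)\cdots(x+t-1)/t!$ (so for integer $n$, $\left\langle {n \atop t}\right\rangle=\binom{n+t-1}{t}=|\mathcal{M}_n(t)|$). For $\mathcal{A}\subseteq\mathcal{M}_n(t)$, its shadow is $\partial\mathcal{A}=\{C\in\mathcal{M}_n(t-1)\mid C\subset A \text{ for some } A\in\mathcal{A}\}$ (multiset inclusion). -}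

module Defs where

open import Data.Nat as ℕ using (ℕ; zero; suc; _≤_)
open import Data.Integer using (+_)
open import Data.Rational as ℚ using (ℚ; _/_; 1ℚ)
open import Data.Vec using (Vec; sum)
open import Data.Vec.Relation.Binary.Pointwise.Inductive using (Pointwise)
open import Data.List using (List)
open import Data.List.Membership.Propositional using (_∈_)
open import Data.Product using (∃-syntax; _×_)
open import Relation.Binary.PropositionalEquality using (_≡_)

-- A multiset of [n] = {1..n}, represented by its multiplicity vector.
Multiset : ℕ → Set
Multiset n = Vec ℕ n

size : ∀ {n} → Multiset n → ℕ
size = sum

InM : ∀ {n} → ℕ → Multiset n → Set
InM t A = size A ≡ t

_⊆ₘ_ : ∀ {n} → Multiset n → Multiset n → Set
C ⊆ₘ A = Pointwise _≤_ C A

InShadow : ∀ {n} → ℕ → List (Multiset n) → Multiset n → Set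
InShadow t 𝓐 C = InM (t ℕ.∸ 1) C × ∃[ A ] (A ∈ 𝓐 × C ⊆ₘ A)

ℕ→ℚ : ℕ → ℚ
ℕ→ℚ m = + m / 1

-- ⟨ y , t ⟩ = y (y+1) ⋯ (y+t-1) / t!
multichoose : ℚ → ℕ → ℚ
multichoose y zero = 1ℚ
multichoose y (suc t) = multichoose y t ℚ.* ((y ℚ.+ ℕ→ℚ t) ℚ.* (+ 1 / suc t))

{-# OPTIONS --safe #-}
module Submission where

-- Encode a family of multisets of [n] by its indicator function on ℕⁿ and count it level by
-- level. For each coordinate k ≥ 1, the compression in the plane of coordinates 0 and k
-- replaces the members on every line a + b = M of that plane by equally many points with the
-- largest coordinate 0; it keeps the size of the family and does not enlarge its shadow.
-- After all compressions the family G is stable (v + eₖ ∈ G implies v + e₀ ∈ G), so ∂G is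
-- the link G₁ = {v | v + e₀ ∈ G}. With G₀ the members avoiding 0, |G| = |G₀| + |G₁| (G₁ one
-- level lower), and Pascal's rule ⟨y, s+1⟩ = ⟨y-1, s+1⟩ + ⟨y, s⟩ yields ⟨y, s⟩ ≤ |G₁|:
-- directly if |G₀| < ⟨y-1, s+1⟩; otherwise induction on n gives |∂G₀| ≥ ⟨y-1, s⟩, and
-- ∂G₀ ⊆ (G₁)₀ lets the same argument run for G₁ one level lower. For y ≤ 1 it suffices
-- that the shadow is nonempty, as ⟨y, s⟩ ≤ 1.

open import Defs

module MultichooseProperties where

  open import Data.Nat.Base as ℕ using (ℕ; zero; suc)
  import Data.Nat.Properties as ℕ
  open import Data.Nat.Coprimality using (1-coprimeTo) renaming (sym to coprime-sym)
  open import Data.Integer.Base as ℤ using (+_)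
  import Data.Integer.Properties as ℤ
  open import Data.Rational.Base
  open import Data.Rational.Properties
  open import Data.Rational.Solver using (module +-*-Solver)
  open import Data.Product.Base using (_,_)
  open import Relation.Binary.PropositionalEquality
    using (_≡_; refl; sym; cong; cong₂; trans; module ≡-Reasoning)

  private
    ℕ→ℚ≡mkℚ : ∀ n → ℕ→ℚ n ≡ mkℚ (+ n) 0 (coprime-sym (1-coprimeTo n))
    ℕ→ℚ≡mkℚ n = normalize-coprime (coprime-sym (1-coprimeTo n))

    1/suc : ℕ → ℚ
    1/suc s = + 1 / suc s

    1/suc≡mkℚ : ∀ s → 1/suc s ≡ mkℚ (+ 1) s (1-coprimeTo (suc s))
    1/suc≡mkℚ s = normalize-coprime (1-coprimeTo (suc s))

    ℕ→ℚ-suc-*-1/suc : ∀ s → ℕ→ℚ (suc s) * 1/suc s ≡ 1ℚ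
    ℕ→ℚ-suc-*-1/suc s rewrite ℕ→ℚ≡mkℚ (suc s) | 1/suc≡mkℚ s =
      *-inverseʳ (mkℚ (+ suc s) 0 (coprime-sym (1-coprimeTo (suc s))))

    1/suc-pos : ∀ s → 0ℚ < 1/suc s
    1/suc-pos s rewrite 1/suc≡mkℚ s = positive⁻¹ _

    *-nonNeg : ∀ {p q} → 0ℚ ≤ p → 0ℚ ≤ q → 0ℚ ≤ p * q
    *-nonNeg {p} {q} 0≤p 0≤q =
      nonNegative⁻¹ _ {{nonNeg*nonNeg⇒nonNeg p {{nonNegative 0≤p}} q {{nonNegative 0≤q}}}}

    *-pos : ∀ {p q} → 0ℚ < p → 0ℚ < q → 0ℚ < p * q
    *-pos {p} {q} 0<p 0<q = positive⁻¹ _ {{pos*pos⇒pos p {{positive 0<p}} q {{positive 0<q}}}}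

  ℕ→ℚ-+ : ∀ m n → ℕ→ℚ (m ℕ.+ n) ≡ ℕ→ℚ m + ℕ→ℚ n
  ℕ→ℚ-+ m n rewrite ℕ→ℚ≡mkℚ m | ℕ→ℚ≡mkℚ n = /-cong
    (trans (ℤ.pos-+ m n) (cong₂ ℤ._+_ (sym (ℤ.*-identityʳ (+ m))) (sym (ℤ.*-identityʳ (+ n)))))
    refl

  ℕ→ℚ-suc : ∀ n → ℕ→ℚ (suc n) ≡ ℕ→ℚ n + 1ℚ
  ℕ→ℚ-suc n = trans (cong ℕ→ℚ (ℕ.+-comm 1 n)) (ℕ→ℚ-+ n 1)

  ℕ→ℚ-nonNeg : ∀ n → 0ℚ ≤ ℕ→ℚ n
  ℕ→ℚ-nonNeg n rewrite ℕ→ℚ≡mkℚ n = nonNegative⁻¹ _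

  ℕ→ℚ-mono-≤ : ∀ {m n} → m ℕ.≤ n → ℕ→ℚ m ≤ ℕ→ℚ n
  ℕ→ℚ-mono-≤ {m} m≤n with ℕ.m≤n⇒∃[o]m+o≡n m≤n
  ... | o , refl = begin
    ℕ→ℚ m          ≡⟨ +-identityʳ (ℕ→ℚ m) ⟨
    ℕ→ℚ m + 0ℚ     ≤⟨ +-monoʳ-≤ (ℕ→ℚ m) (ℕ→ℚ-nonNeg o) ⟩
    ℕ→ℚ m + ℕ→ℚ o  ≡⟨ ℕ→ℚ-+ m o ⟨
    ℕ→ℚ (m ℕ.+ o)  ∎
    where open ≤-Reasoning

  ℕ→ℚ-cancel-< : ∀ {m n} → ℕ→ℚ m < ℕ→ℚ n → m ℕ.< n
  ℕ→ℚ-cancel-< m<n = ℕ.≰⇒> λ n≤m → <-irrefl refl (<-≤-trans m<n (ℕ→ℚ-mono-≤ n≤m))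

  private
    multichoose-pred : ∀ y s →
      multichoose (y - 1ℚ) (suc s) ≡ multichoose y s * ((y - 1ℚ) * 1/suc s)
    multichoose-pred y zero = cong (λ z → 1ℚ * (z * 1/suc 0)) (+-identityʳ (y - 1ℚ))
    multichoose-pred y (suc s) rewrite multichoose-pred y s | ℕ→ℚ-suc s =
      solve 5 (λ M y n d d′ → (M :* ((y :- con 1ℚ) :* d)) :* (((y :- con 1ℚ) :+ (n :+ con 1ℚ)) :* d′)
                           := (M :* ((y :+ n) :* d)) :* ((y :- con 1ℚ) :* d′))
        refl (multichoose y s) y (ℕ→ℚ s) (1/suc s) (1/suc (suc s))
      where open +-*-Solver

  multichoose-pascal : ∀ y s →
    multichoose y (suc s) ≡ multichoose (y - 1ℚ) (suc s) + multichoose y s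
  multichoose-pascal y s = begin
    M * ((y + ℕ→ℚ s) * 1/suc s)
      ≡⟨ solve 4 (λ M y n d → M :* ((y :+ n) :* d) := M :* ((y :- con 1ℚ) :* d) :+ M :* ((n :+ con 1ℚ) :* d))
           refl M y (ℕ→ℚ s) (1/suc s) ⟩
    M * ((y - 1ℚ) * 1/suc s) + M * ((ℕ→ℚ s + 1ℚ) * 1/suc s)
      ≡⟨ cong (λ z → M * ((y - 1ℚ) * 1/suc s) + M * (z * 1/suc s)) (ℕ→ℚ-suc s) ⟨
    M * ((y - 1ℚ) * 1/suc s) + M * (ℕ→ℚ (suc s) * 1/suc s)
      ≡⟨ cong (λ z → M * ((y - 1ℚ) * 1/suc s) + M * z) (ℕ→ℚ-suc-*-1/suc s) ⟩
    M * ((y - 1ℚ) * 1/suc s) + M * 1ℚ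
      ≡⟨ cong₂ _+_ (sym (multichoose-pred y s)) (*-identityʳ M) ⟩
    multichoose (y - 1ℚ) (suc s) + M ∎
    where
      open +-*-Solver
      open ≡-Reasoning
      M = multichoose y s

  multichoose-nonNeg : ∀ {y} s → 0ℚ ≤ y → 0ℚ ≤ multichoose y s
  multichoose-nonNeg zero 0≤y = nonNegative⁻¹ 1ℚ
  multichoose-nonNeg {y} (suc s) 0≤y = *-nonNeg (multichoose-nonNeg s 0≤y)
    (*-nonNeg (+-mono-≤ 0≤y (ℕ→ℚ-nonNeg s)) (<⇒≤ (1/suc-pos s)))

  multichoose-pos : ∀ {y} s → 0ℚ < y → 0ℚ < multichoose y s
  multichoose-pos zero 0<y = positive⁻¹ 1ℚ
  multichoose-pos {y} (suc s) 0<y = *-pos (multichoose-pos s 0<y)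
    (*-pos (+-mono-<-≤ 0<y (ℕ→ℚ-nonNeg s)) (1/suc-pos s))

  multichoose≤1 : ∀ {y} s → 0ℚ ≤ y → y ≤ 1ℚ → multichoose y s ≤ 1ℚ
  multichoose≤1 zero 0≤y y≤1 = ≤-refl
  multichoose≤1 {y} (suc s) 0≤y y≤1 = begin
    multichoose y s * ((y + ℕ→ℚ s) * 1/suc s)
      ≤⟨ *-monoˡ-≤-nonNeg (multichoose y s) {{nonNegative (multichoose-nonNeg s 0≤y)}} factor≤1 ⟩
    multichoose y s * 1ℚ
      ≡⟨ *-identityʳ (multichoose y s) ⟩
    multichoose y s
      ≤⟨ multichoose≤1 s 0≤y y≤1 ⟩
    1ℚ ∎
    where
      open ≤-Reasoning
      factor≤1 : (y + ℕ→ℚ s) * 1/suc s ≤ 1ℚ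
      factor≤1 = begin
        (y + ℕ→ℚ s) * 1/suc s
          ≤⟨ *-monoʳ-≤-nonNeg (1/suc s) {{nonNegative (<⇒≤ (1/suc-pos s))}} (+-monoˡ-≤ (ℕ→ℚ s) y≤1) ⟩
        (1ℚ + ℕ→ℚ s) * 1/suc s
          ≡⟨ cong (_* 1/suc s) (trans (+-comm 1ℚ (ℕ→ℚ s)) (sym (ℕ→ℚ-suc s))) ⟩
        ℕ→ℚ (suc s) * 1/suc s
          ≡⟨ ℕ→ℚ-suc-*-1/suc s ⟩
        1ℚ ∎

module Families where

  open import Data.Nat.Base
  open import Data.Nat.Properties
  open import Algebra.Properties.CommutativeSemigroup +-commutativeSemigroup
    using () renaming (interchange to +-interchange)
  open import Data.Bool.Base using (Bool; true; false; T; _∨_)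
  open import Data.Bool.Properties using (T-∨; ∨-identityʳ; ∨-assoc)
  open import Data.Bool.Solver using (module ∨-∧-Solver)
  open import Data.Empty using (⊥; ⊥-elim)
  open import Data.Fin.Base using (Fin; zero; suc)
  open import Data.List.Base using (List; []; _∷_; allFin; length)
  open import Data.List.Membership.Propositional using (_∈_)
  open import Data.List.Membership.Propositional.Properties using (∈-allFin)
  open import Data.List.Relation.Unary.All as All using (All; []; _∷_)
  open import Data.List.Relation.Unary.Any using (here; there; any?)
  open import Data.List.Relation.Unary.Unique.Propositional using (Unique; []; _∷_)
  open import Data.Product.Base using (∃-syntax; _×_; _,_)
  open import Data.Sum.Base as Sum using (_⊎_; inj₁; inj₂)
  open import Data.Vec.Base using ([]; _∷_; head; tail; _[_]%=_)
  open import Data.Vec.Properties using (∷-injectiveˡ; ∷-injectiveʳ; ≡-dec)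
  open import Data.Vec.Relation.Binary.Pointwise.Inductive as Pointwise using ([]; _∷_)
  open import Function.Base using (_∘_; id)
  open import Function.Bundles using (_⇔_; Equivalence; mk⇔)
  open import Relation.Binary.Definitions using (DecidableEquality)
  open import Relation.Binary.PropositionalEquality
    using (_≡_; _≢_; refl; sym; trans; cong; cong₂; subst; module ≡-Reasoning)
  open import Relation.Nullary using (yes; no)
  open import Relation.Nullary.Decidable using (Dec; does; _because_; dec-true; dec-false)
  open import Relation.Nullary.Reflects using (invert)

  ∑-antidiag : ℕ → (ℕ → ℕ → ℕ) → ℕ
  ∑-antidiag zero    h = h 0 0
  ∑-antidiag (suc m) h = h 0 (suc m) + ∑-antidiag m (λ a b → h (suc a) b)

  ∑-antidiag-cong : ∀ m {h h′} → (∀ a b → a + b ≡ m → h a b ≡ h′ a b) →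
                    ∑-antidiag m h ≡ ∑-antidiag m h′
  ∑-antidiag-cong zero    eq = eq 0 0 refl
  ∑-antidiag-cong (suc m) eq =
    cong₂ _+_ (eq 0 (suc m) refl) (∑-antidiag-cong m λ a b e → eq (suc a) b (cong suc e))

  ∑-antidiag-mono : ∀ m {h h′} → (∀ a b → a + b ≡ m → h a b ≤ h′ a b) →
                    ∑-antidiag m h ≤ ∑-antidiag m h′
  ∑-antidiag-mono zero    le = le 0 0 refl
  ∑-antidiag-mono (suc m) le =
    +-mono-≤ (le 0 (suc m) refl) (∑-antidiag-mono m λ a b e → le (suc a) b (cong suc e))

  ∑-antidiag-zero : ∀ m → ∑-antidiag m (λ _ _ → 0) ≡ 0
  ∑-antidiag-zero zero    = refl
  ∑-antidiag-zero (suc m) = ∑-antidiag-zero m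

  ∑-antidiag-+ : ∀ m h g → ∑-antidiag m (λ a b → h a b + g a b) ≡ ∑-antidiag m h + ∑-antidiag m g
  ∑-antidiag-+ zero    h g = refl
  ∑-antidiag-+ (suc m) h g = begin
    h 0 (suc m) + g 0 (suc m) + ∑-antidiag m (λ a b → h (suc a) b + g (suc a) b)
      ≡⟨ cong (h 0 (suc m) + g 0 (suc m) +_) (∑-antidiag-+ m (λ a → h (suc a)) (λ a → g (suc a))) ⟩
    h 0 (suc m) + g 0 (suc m) + (∑-antidiag m (λ a → h (suc a)) + ∑-antidiag m (λ a → g (suc a)))
      ≡⟨ +-interchange (h 0 (suc m)) (g 0 (suc m)) _ _ ⟩
    h 0 (suc m) + ∑-antidiag m (λ a → h (suc a)) + (g 0 (suc m) + ∑-antidiag m (λ a → g (suc a))) ∎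
    where open ≡-Reasoning

  ∑-antidiag-last : ∀ m h → ∑-antidiag (suc m) h ≡ ∑-antidiag m (λ a b → h a (suc b)) + h (suc m) 0
  ∑-antidiag-last zero    h = refl
  ∑-antidiag-last (suc m) h =
    trans (cong (h 0 (suc (suc m)) +_) (∑-antidiag-last m (λ a → h (suc a))))
          (sym (+-assoc (h 0 (suc (suc m))) _ _))

  ∑-antidiag-swap : ∀ m h → ∑-antidiag m h ≡ ∑-antidiag m (λ a b → h b a)
  ∑-antidiag-swap zero    h = refl
  ∑-antidiag-swap (suc m) h = begin
    h 0 (suc m) + ∑-antidiag m (λ a → h (suc a))
      ≡⟨ cong (h 0 (suc m) +_) (∑-antidiag-swap m (λ a → h (suc a))) ⟩
    h 0 (suc m) + ∑-antidiag m (λ a b → h (suc b) a)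
      ≡⟨ +-comm (h 0 (suc m)) _ ⟩
    ∑-antidiag m (λ a b → h (suc b) a) + h 0 (suc m)
      ≡⟨ ∑-antidiag-last m (λ a b → h b a) ⟨
    ∑-antidiag (suc m) (λ a b → h b a) ∎
    where open ≡-Reasoning

  ∑-antidiag-assoc : ∀ t (g : ℕ → ℕ → ℕ → ℕ) →
    ∑-antidiag t (λ a r → ∑-antidiag r (λ b c → g a b c)) ≡
    ∑-antidiag t (λ s c → ∑-antidiag s (λ a b → g a b c))
  ∑-antidiag-assoc zero    g = refl
  ∑-antidiag-assoc (suc t) g = begin
    ∑-antidiag (suc t) (g 0) + ∑-antidiag t (λ a r → ∑-antidiag r (g (suc a)))
      ≡⟨ cong (∑-antidiag (suc t) (g 0) +_) (∑-antidiag-assoc t (λ a → g (suc a))) ⟩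
    g 0 0 (suc t) + ∑-antidiag t (λ b → g 0 (suc b)) + ∑-antidiag t g′
      ≡⟨ +-assoc (g 0 0 (suc t)) _ _ ⟩
    g 0 0 (suc t) + (∑-antidiag t (λ b → g 0 (suc b)) + ∑-antidiag t g′)
      ≡⟨ cong (g 0 0 (suc t) +_) (∑-antidiag-+ t (λ b → g 0 (suc b)) g′) ⟨
    g 0 0 (suc t) + ∑-antidiag t (λ s c → g 0 (suc s) c + g′ s c) ∎
    where
      open ≡-Reasoning
      g′ : ℕ → ℕ → ℕ
      g′ s c = ∑-antidiag s (λ a b → g (suc a) b c)

  ∑-antidiag-witness : ∀ m h → 0 < ∑-antidiag m h → ∃[ a ] ∃[ b ] (a + b ≡ m × 0 < h a b)
  ∑-antidiag-witness zero    h 0<h = 0 , 0 , refl , 0<h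
  ∑-antidiag-witness (suc m) h 0<∑ with h 0 (suc m) ≟ 0
  ... | no  h≢0 = 0 , suc m , refl , n≢0⇒n>0 h≢0
  ... | yes h≡0
    with ∑-antidiag-witness m (λ a → h (suc a)) (subst (λ x → 0 < x + ∑-antidiag m (λ a → h (suc a))) h≡0 0<∑)
  ...   | a , b , a+b≡m , 0<h = suc a , b , cong suc a+b≡m , 0<h

  ∑-antidiag-term : ∀ m h {a b} → a + b ≡ m → h a b ≤ ∑-antidiag m h
  ∑-antidiag-term zero    h {zero}  {zero} refl = ≤-refl
  ∑-antidiag-term (suc m) h {zero}         refl = m≤m+n _ _
  ∑-antidiag-term (suc m) h {suc a}        e    =
    ≤-trans (∑-antidiag-term m (λ a → h (suc a)) (suc-injective e)) (m≤n+m _ _)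

  ∑-antidiag-point : ∀ a b h → (∀ a′ b′ → a′ ≢ a → h a′ b′ ≡ 0) → ∑-antidiag (a + b) h ≡ h a b
  ∑-antidiag-point zero    zero    h off = refl
  ∑-antidiag-point zero    (suc b) h off = begin
    h 0 (suc b) + ∑-antidiag b (λ a → h (suc a))
      ≡⟨ cong (h 0 (suc b) +_) (∑-antidiag-cong b λ a′ b′ _ → off (suc a′) b′ λ ()) ⟩
    h 0 (suc b) + ∑-antidiag b (λ _ _ → 0)
      ≡⟨ cong (h 0 (suc b) +_) (∑-antidiag-zero b) ⟩
    h 0 (suc b) + 0
      ≡⟨ +-identityʳ _ ⟩
    h 0 (suc b) ∎
    where open ≡-Reasoning
  ∑-antidiag-point (suc a) b h off =
    trans (cong (_+ ∑-antidiag (a + b) (λ a → h (suc a))) (off 0 (suc (a + b)) λ ()))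
          (∑-antidiag-point a b (λ a → h (suc a)) λ a′ b′ a′≢a →
             off (suc a′) b′ (a′≢a ∘ suc-injective))

  ∑-level : ∀ {n} → ℕ → (Multiset n → ℕ) → ℕ
  ∑-level {zero}  zero    f = f []
  ∑-level {zero}  (suc t) f = 0
  ∑-level {suc n} t       f = ∑-antidiag t (λ a r → ∑-level r (λ v → f (a ∷ v)))

  ∑-level-cong : ∀ {n} t {f g : Multiset n → ℕ} → (∀ v → size v ≡ t → f v ≡ g v) →
                 ∑-level t f ≡ ∑-level t g
  ∑-level-cong {zero}  zero    eq = eq [] refl
  ∑-level-cong {zero}  (suc t) eq = refl
  ∑-level-cong {suc n} t       eq = ∑-antidiag-cong t λ a r a+r≡t →
    ∑-level-cong r λ v ∣v∣≡r → eq (a ∷ v) (trans (cong (a +_) ∣v∣≡r) a+r≡t)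

  ∑-level-mono : ∀ {n} t {f g : Multiset n → ℕ} → (∀ v → size v ≡ t → f v ≤ g v) →
                 ∑-level t f ≤ ∑-level t g
  ∑-level-mono {zero}  zero    le = le [] refl
  ∑-level-mono {zero}  (suc t) le = z≤n
  ∑-level-mono {suc n} t       le = ∑-antidiag-mono t λ a r a+r≡t →
    ∑-level-mono r λ v ∣v∣≡r → le (a ∷ v) (trans (cong (a +_) ∣v∣≡r) a+r≡t)

  ∑-level-zero : ∀ {n} t → ∑-level {n} t (λ _ → 0) ≡ 0
  ∑-level-zero {zero}  zero    = refl
  ∑-level-zero {zero}  (suc t) = refl
  ∑-level-zero {suc n} t       = trans (∑-antidiag-cong t λ _ r _ → ∑-level-zero {n} r) (∑-antidiag-zero t)

  ∑-level-+ : ∀ {n} t (f g : Multiset n → ℕ) →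
              ∑-level t (λ v → f v + g v) ≡ ∑-level t f + ∑-level t g
  ∑-level-+ {zero}  zero    f g = refl
  ∑-level-+ {zero}  (suc t) f g = refl
  ∑-level-+ {suc n} t       f g =
    trans (∑-antidiag-cong t λ a r _ → ∑-level-+ r (λ v → f (a ∷ v)) (λ v → g (a ∷ v)))
          (∑-antidiag-+ t _ _)

  ∑-level-∑-antidiag : ∀ {n} t m (f : ℕ → ℕ → Multiset n → ℕ) →
    ∑-level t (λ v → ∑-antidiag m (λ a b → f a b v)) ≡ ∑-antidiag m (λ a b → ∑-level t (f a b))
  ∑-level-∑-antidiag t zero    f = refl
  ∑-level-∑-antidiag t (suc m) f =
    trans (∑-level-+ t (f 0 (suc m)) _)
          (cong (∑-level t (f 0 (suc m)) +_) (∑-level-∑-antidiag t m (λ a → f (suc a))))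

  ∑-level-byLines : ∀ {m} t (f : Multiset (2 + m) → ℕ) →
    ∑-level t f ≡ ∑-level t (λ u → ∑-antidiag (head u) (λ a b → f (a ∷ b ∷ tail u)))
  ∑-level-byLines t f = begin
    ∑-antidiag t (λ a r → ∑-antidiag r (λ b q → ∑-level q (λ w → f (a ∷ b ∷ w))))
      ≡⟨ ∑-antidiag-assoc t (λ a b q → ∑-level q (λ w → f (a ∷ b ∷ w))) ⟩
    ∑-antidiag t (λ s q → ∑-antidiag s (λ a b → ∑-level q (λ w → f (a ∷ b ∷ w))))
      ≡⟨ ∑-antidiag-cong t (λ s q _ → ∑-level-∑-antidiag q s (λ a b w → f (a ∷ b ∷ w))) ⟨
    ∑-antidiag t (λ s q → ∑-level q (λ w → ∑-antidiag s (λ a b → f (a ∷ b ∷ w)))) ∎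
    where open ≡-Reasoning

  ∑-level-byFibres₁ : ∀ {m} t (f : Multiset (2 + m) → ℕ) →
    ∑-level t f ≡ ∑-antidiag t (λ c r → ∑-level r (λ u → f (head u ∷ c ∷ tail u)))
  ∑-level-byFibres₁ t f = begin
    ∑-antidiag t (λ a r → ∑-antidiag r (λ c q → g a c q))
      ≡⟨ ∑-antidiag-assoc t g ⟩
    ∑-antidiag t (λ s q → ∑-antidiag s (λ a c → g a c q))
      ≡⟨ ∑-antidiag-cong t (λ s q _ → ∑-antidiag-swap s (λ a c → g a c q)) ⟩
    ∑-antidiag t (λ s q → ∑-antidiag s (λ c a → g a c q))
      ≡⟨ ∑-antidiag-assoc t (λ c a → g a c) ⟨
    ∑-antidiag t (λ c r → ∑-antidiag r (λ a q → g a c q)) ∎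
    where
      open ≡-Reasoning
      g : ℕ → ℕ → ℕ → ℕ
      g a c q = ∑-level q (λ w → f (a ∷ c ∷ w))

  ∑-level-witness : ∀ {n} t (f : Multiset n → ℕ) → 0 < ∑-level t f → ∃[ v ] (size v ≡ t × 0 < f v)
  ∑-level-witness {zero}  zero    f 0<f = [] , refl , 0<f
  ∑-level-witness {suc n} t       f 0<∑ with ∑-antidiag-witness t _ 0<∑
  ... | a , r , a+r≡t , 0<∑′ with ∑-level-witness r (λ v → f (a ∷ v)) 0<∑′
  ...   | v , ∣v∣≡r , 0<f = a ∷ v , trans (cong (a +_) ∣v∣≡r) a+r≡t , 0<f

  ∑-level-term : ∀ {n} (f : Multiset n → ℕ) v → f v ≤ ∑-level (size v) f
  ∑-level-term f []      = ≤-refl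
  ∑-level-term f (a ∷ v) = ≤-trans (∑-level-term (λ w → f (a ∷ w)) v)
    (∑-antidiag-term (a + size v) (λ a r → ∑-level r (λ w → f (a ∷ w))) refl)

  ∑-level-point : ∀ {n} (f : Multiset n → ℕ) x → (∀ v → v ≢ x → f v ≡ 0) → ∑-level (size x) f ≡ f x
  ∑-level-point f []      off = refl
  ∑-level-point {suc n} f (a ∷ x) off = begin
    ∑-antidiag (a + size x) (λ a′ r → ∑-level r (λ v → f (a′ ∷ v)))
      ≡⟨ ∑-antidiag-point a (size x) _ (λ a′ r a′≢a → trans
           (∑-level-cong r (λ v _ → off (a′ ∷ v) (a′≢a ∘ ∷-injectiveˡ))) (∑-level-zero {n} r)) ⟩
    ∑-level (size x) (λ v → f (a ∷ v))
      ≡⟨ ∑-level-point (λ v → f (a ∷ v)) x (λ v v≢x → off (a ∷ v) (v≢x ∘ ∷-injectiveʳ)) ⟩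
    f (a ∷ x) ∎
    where open ≡-Reasoning

  Family : ℕ → Set
  Family n = Multiset n → Bool

  𝟙 : Bool → ℕ
  𝟙 true  = 1
  𝟙 false = 0

  count : ∀ {n} → ℕ → Family n → ℕ
  count t F = ∑-level t (λ v → 𝟙 (F v))

  _∪_ : ∀ {n} → Family n → Family n → Family n
  (F ∪ G) v = F v ∨ G v

  ∅ : ∀ {n} → Family n
  ∅ _ = false

  private
    T-∨ˡ : ∀ {p} q → T p → T (p ∨ q)
    T-∨ˡ {true} q _ = _

    T-∨ʳ : ∀ p {q} → T q → T (p ∨ q)
    T-∨ʳ true  _ = _
    T-∨ʳ false t = t

  𝟙-mono : ∀ {p q} → (T p → T q) → 𝟙 p ≤ 𝟙 q
  𝟙-mono {false}         _   = z≤n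
  𝟙-mono {true}  {true}  _   = ≤-refl
  𝟙-mono {true}  {false} p⇒q = ⊥-elim (p⇒q _)

  𝟙-pos : ∀ {p} → 0 < 𝟙 p → T p
  𝟙-pos {true} _ = _

  𝟙≤1 : ∀ p → 𝟙 p ≤ 1
  𝟙≤1 true  = ≤-refl
  𝟙≤1 false = z≤n

  count-mono : ∀ {n} t (F G : Family n) → (∀ v → size v ≡ t → T (F v) → T (G v)) →
               count t F ≤ count t G
  count-mono t F G F⇒G = ∑-level-mono t λ v ∣v∣≡t → 𝟙-mono (F⇒G v ∣v∣≡t)

  count-cong : ∀ {n} t (F G : Family n) → (∀ v → size v ≡ t → F v ≡ G v) →
               count t F ≡ count t G
  count-cong t F G F≡G = ∑-level-cong t λ v e → cong 𝟙 (F≡G v e)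

  count-⇔ : ∀ {n} t (F G : Family n) → (∀ v → size v ≡ t → T (F v) ⇔ T (G v)) →
            count t F ≡ count t G
  count-⇔ t F G F⇔G = ≤-antisym (count-mono t F G λ v e → Equivalence.to (F⇔G v e))
                                 (count-mono t G F λ v e → Equivalence.from (F⇔G v e))

  count-witness : ∀ {n} t (F : Family n) → 1 ≤ count t F → ∃[ v ] (size v ≡ t × T (F v))
  count-witness t F 0<count with ∑-level-witness t _ 0<count
  ... | v , ∣v∣≡t , 0<𝟙 = v , ∣v∣≡t , 𝟙-pos 0<𝟙

  count-member : ∀ {n} (F : Family n) v → T (F v) → 1 ≤ count (size v) F
  count-member F v v∈F = ≤-trans (𝟙-mono {true} λ _ → v∈F) (∑-level-term (λ v → 𝟙 (F v)) v)

  ∂ : ∀ {n} → Family n → Family n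
  ∂ {zero}  F []      = false
  ∂ {suc n} F (a ∷ v) = F (suc a ∷ v) ∨ ∂ (λ w → F (a ∷ w)) v

  ∂-sound : ∀ {n} (F : Family n) v → T (∂ F v) → ∃[ j ] T (F (v [ j ]%= suc))
  ∂-sound F (a ∷ v) v∈∂F with Equivalence.to T-∨ v∈∂F
  ... | inj₁ a+1∈F = zero , a+1∈F
  ... | inj₂ v∈∂F′ with ∂-sound (λ w → F (a ∷ w)) v v∈∂F′
  ...   | j , v+j∈F = suc j , v+j∈F

  ∂-complete : ∀ {n} (F : Family n) v j → T (F (v [ j ]%= suc)) → T (∂ F v)
  ∂-complete F (a ∷ v) zero    a+1∈F = T-∨ˡ _ a+1∈F
  ∂-complete F (a ∷ v) (suc j) v+j∈F = T-∨ʳ (F (suc a ∷ v)) (∂-complete (λ w → F (a ∷ w)) v j v+j∈F)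

  size-[]%=suc : ∀ {n} (v : Multiset n) j → size (v [ j ]%= suc) ≡ suc (size v)
  size-[]%=suc (a ∷ v) zero    = refl
  size-[]%=suc (a ∷ v) (suc j) = trans (cong (a +_) (size-[]%=suc v j)) (+-suc a (size v))

  size≡suc⇒[]%=suc : ∀ {n} (v : Multiset n) {s} → size v ≡ suc s → ∃[ j ] ∃[ u ] (v ≡ u [ j ]%= suc)
  size≡suc⇒[]%=suc (suc a ∷ v) _ = zero , a ∷ v , refl
  size≡suc⇒[]%=suc (zero  ∷ v) ∣v∣≡1+s with size≡suc⇒[]%=suc v ∣v∣≡1+s
  ... | j , u , refl = suc j , zero ∷ u , refl

  ∂-nonempty : ∀ {n} s (F : Family n) → 1 ≤ count (suc s) F → 1 ≤ count s (∂ F)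
  ∂-nonempty s F nonempty with count-witness (suc s) F nonempty
  ... | v , ∣v∣≡1+s , v∈F with size≡suc⇒[]%=suc v ∣v∣≡1+s
  ...   | j , u , refl = subst (λ r → 1 ≤ count r (∂ F))
                               (suc-injective (trans (sym (size-[]%=suc u j)) ∣v∣≡1+s))
                               (count-member (∂ F) u (∂-complete F u j v∈F))

  -- Compressions

  lineCount : ∀ {m} → Family (2 + m) → ℕ → Multiset m → ℕ
  lineCount F M v = ∑-antidiag M (λ a b → 𝟙 (F (a ∷ b ∷ v)))

  fibre₁ : ∀ {m} → Family (2 + m) → ℕ → Family (suc m)
  fibre₁ F c u = F (head u ∷ c ∷ tail u)

  -- On every line a + b = M of the plane of coordinates 0 and k + 1, compress k keeps as many
  -- points as F has there, namely those with the largest coordinate 0.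
  compress : ∀ {m} → Fin m → Family (suc m) → Family (suc m)
  compress zero    F (a ∷ b ∷ v) = b <ᵇ lineCount F (a + b) v
  compress (suc k) F (a ∷ c ∷ w) = compress k (fibre₁ F c) (a ∷ w)

  count-byLines : ∀ {m} t (F : Family (2 + m)) → count t F ≡ ∑-level t (λ u → lineCount F (head u) (tail u))
  count-byLines t F = ∑-level-byLines t (λ v → 𝟙 (F v))

  count-byFibres₁ : ∀ {m} t (F : Family (2 + m)) → count t F ≡ ∑-antidiag t (λ c r → count r (fibre₁ F c))
  count-byFibres₁ t F = ∑-level-byFibres₁ t (λ v → 𝟙 (F v))

  ∑-antidiag-𝟙≤ : ∀ M (h : ℕ → ℕ → Bool) → ∑-antidiag M (λ a b → 𝟙 (h a b)) ≤ suc M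
  ∑-antidiag-𝟙≤ zero    h = 𝟙≤1 (h 0 0)
  ∑-antidiag-𝟙≤ (suc M) h = +-mono-≤ (𝟙≤1 (h 0 (suc M))) (∑-antidiag-𝟙≤ M (λ a → h (suc a)))

  private
    𝟙-<ᵇ-+-⊓ : ∀ m n → 𝟙 (m <ᵇ n) + n ⊓ m ≡ n ⊓ suc m
    𝟙-<ᵇ-+-⊓ m       zero    = refl
    𝟙-<ᵇ-+-⊓ zero    (suc n) = cong suc (sym (⊓-zeroʳ n))
    𝟙-<ᵇ-+-⊓ (suc m) (suc n) = trans (+-suc (𝟙 (m <ᵇ n)) (n ⊓ m)) (cong suc (𝟙-<ᵇ-+-⊓ m n))

  ∑-antidiag-<ᵇ : ∀ M N → ∑-antidiag M (λ _ b → 𝟙 (b <ᵇ N)) ≡ N ⊓ suc M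
  ∑-antidiag-<ᵇ zero    zero    = refl
  ∑-antidiag-<ᵇ zero    (suc N) = cong suc (sym (⊓-zeroʳ N))
  ∑-antidiag-<ᵇ (suc M) N       =
    trans (cong (𝟙 (suc M <ᵇ N) +_) (∑-antidiag-<ᵇ M N)) (𝟙-<ᵇ-+-⊓ (suc M) N)

  lineCount-compress₀ : ∀ {m} (F : Family (2 + m)) M v → lineCount (compress zero F) M v ≡ lineCount F M v
  lineCount-compress₀ F M v = begin
    ∑-antidiag M (λ a b → 𝟙 (b <ᵇ lineCount F (a + b) v))
      ≡⟨ ∑-antidiag-cong M (λ a b a+b≡M → cong (λ M′ → 𝟙 (b <ᵇ lineCount F M′ v)) a+b≡M) ⟩
    ∑-antidiag M (λ _ b → 𝟙 (b <ᵇ lineCount F M v))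
      ≡⟨ ∑-antidiag-<ᵇ M (lineCount F M v) ⟩
    lineCount F M v ⊓ suc M
      ≡⟨ m≤n⇒m⊓n≡m (∑-antidiag-𝟙≤ M _) ⟩
    lineCount F M v ∎
    where open ≡-Reasoning

  count-compress : ∀ {m} (k : Fin m) F t → count t (compress k F) ≡ count t F
  count-compress {suc m} zero F t = begin
    count t (compress zero F)                                    ≡⟨ count-byLines t (compress zero F) ⟩
    ∑-level t (λ u → lineCount (compress zero F) (head u) (tail u))
      ≡⟨ ∑-level-cong t (λ u _ → lineCount-compress₀ F (head u) (tail u)) ⟩
    ∑-level t (λ u → lineCount F (head u) (tail u))              ≡⟨ count-byLines t F ⟨
    count t F                                                    ∎
    where open ≡-Reasoning
  count-compress {suc m} (suc k) F t = begin
    count t (compress (suc k) F)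
      ≡⟨ count-byFibres₁ t (compress (suc k) F) ⟩
    ∑-antidiag t (λ c r → count r (fibre₁ (compress (suc k) F) c))
      ≡⟨ ∑-antidiag-cong t (λ c r _ → trans (count-fibre₁-compress c r) (count-compress k (fibre₁ F c) r)) ⟩
    ∑-antidiag t (λ c r → count r (fibre₁ F c))
      ≡⟨ count-byFibres₁ t F ⟨
    count t F ∎
    where
      open ≡-Reasoning
      count-fibre₁-compress : ∀ c r → count r (fibre₁ (compress (suc k) F) c) ≡ count r (compress k (fibre₁ F c))
      count-fibre₁-compress c r =
        count-cong r (fibre₁ (compress (suc k) F) c) (compress k (fibre₁ F c)) λ { (a ∷ w) _ → refl }

  Compressed : ∀ {m} → Fin m → Family (suc m) → Set
  Compressed k F = ∀ v → T (F (v [ suc k ]%= suc)) → T (F (v [ zero ]%= suc))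

  Stable : ∀ {m} → Family (suc m) → Set
  Stable F = ∀ k → Compressed k F

  private
    <ᵇ-mono : ∀ b {A B} → A ≤ B → T (b <ᵇ A) → T (b <ᵇ B)
    <ᵇ-mono b {A} A≤B b<A = <⇒<ᵇ (<-≤-trans (<ᵇ⇒< b A b<A) A≤B)

    <ᵇ-pred : ∀ b A → T (suc b <ᵇ A) → T (b <ᵇ A)
    <ᵇ-pred b A 1+b<A = <⇒<ᵇ (<-trans (n<1+n b) (<ᵇ⇒< (suc b) A 1+b<A))

    lineCount-shift : ∀ M (h h′ : ℕ → ℕ → Bool) → (∀ a b → T (h a b) → T (h′ (suc a) b)) →
      ∑-antidiag M (λ a b → 𝟙 (h a b)) ≤ ∑-antidiag (suc M) (λ a b → 𝟙 (h′ a b))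
    lineCount-shift M h h′ h⇒h′ =
      ≤-trans (∑-antidiag-mono M λ a b _ → 𝟙-mono (h⇒h′ a b)) (m≤n+m _ _)

  compress-shift : ∀ {m} (k : Fin m) (X Y : Family (suc m)) →
    (∀ a w → T (X (a ∷ w)) → T (Y (suc a ∷ w))) →
    ∀ a w → T (compress k X (a ∷ w)) → T (compress k Y (suc a ∷ w))
  compress-shift zero    X Y X⇒Y a (b ∷ v) = <ᵇ-mono b
    (lineCount-shift (a + b) (λ x y → X (x ∷ y ∷ v)) (λ x y → Y (x ∷ y ∷ v)) (λ x y → X⇒Y x (y ∷ v)))
  compress-shift (suc k) X Y X⇒Y a (c ∷ w) =
    compress-shift k (fibre₁ X c) (fibre₁ Y c) (λ a′ w′ → X⇒Y a′ (c ∷ w′)) a w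

  compress₀-compressed₀ : ∀ {m} (F : Family (2 + m)) → Compressed zero (compress zero F)
  compress₀-compressed₀ F (a ∷ b ∷ v) rewrite +-suc a b =
    <ᵇ-pred b (lineCount F (suc (a + b)) v)

  compress-preserves-compressed : ∀ {m} (j k : Fin m) (F : Family (suc m)) →
    Compressed j F → Compressed j (compress k F)
  compress-preserves-compressed zero    zero    F _ = compress₀-compressed₀ F
  compress-preserves-compressed (suc j) zero    F F-comp (a ∷ b ∷ v) = <ᵇ-mono b
    (lineCount-shift (a + b) (λ x y → F (x ∷ y ∷ (v [ j ]%= suc))) (λ x y → F (x ∷ y ∷ v))
                     (λ x y → F-comp (x ∷ y ∷ v)))
  compress-preserves-compressed zero    (suc k) F F-comp (a ∷ c ∷ w) =
    compress-shift k (fibre₁ F (suc c)) (fibre₁ F c) (λ a′ w′ → F-comp (a′ ∷ c ∷ w′)) a w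
  compress-preserves-compressed (suc j) (suc k) F F-comp (a ∷ c ∷ w) =
    compress-preserves-compressed j k (fibre₁ F c) (λ { (a′ ∷ w′) → F-comp (a′ ∷ c ∷ w′) }) (a ∷ w)

  compress-compressed : ∀ {m} (k : Fin m) (F : Family (suc m)) → Compressed k (compress k F)
  compress-compressed zero    F = compress₀-compressed₀ F
  compress-compressed (suc k) F (a ∷ c ∷ w) = compress-compressed k (fibre₁ F c) (a ∷ w)

  maxAbove : ∀ {n} → (Multiset n → ℕ) → Multiset n → ℕ
  maxAbove {zero}  g []      = 0
  maxAbove {suc n} g (a ∷ v) = g (suc a ∷ v) ⊔ maxAbove (λ w → g (a ∷ w)) v

  maxAbove-lub : ∀ {n} (g : Multiset n → ℕ) v {R} → (∀ j → g (v [ j ]%= suc) ≤ R) → maxAbove g v ≤ R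
  maxAbove-lub g []      bound = z≤n
  maxAbove-lub g (a ∷ v) bound = ⊔-lub (bound zero) (maxAbove-lub (λ w → g (a ∷ w)) v (bound ∘ suc))

  private
    <ᵇ-⊔ : ∀ b A B → (b <ᵇ A) ∨ (b <ᵇ B) ≡ (b <ᵇ A ⊔ B)
    <ᵇ-⊔ b       zero    B       = refl
    <ᵇ-⊔ b       (suc A) zero    = ∨-identityʳ _
    <ᵇ-⊔ zero    (suc A) (suc B) = refl
    <ᵇ-⊔ (suc b) (suc A) (suc B) = <ᵇ-⊔ b A B

    <ᵇ-∨-suc : ∀ b A → (b <ᵇ A) ∨ (suc b <ᵇ A) ≡ (b <ᵇ A)
    <ᵇ-∨-suc b       zero    = refl
    <ᵇ-∨-suc zero    (suc A) = refl
    <ᵇ-∨-suc (suc b) (suc A) = <ᵇ-∨-suc b A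

    T-∨-map : ∀ {p p′ q q′} → (T p → T p′) → (T q → T q′) → T (p ∨ q) → T (p′ ∨ q′)
    T-∨-map f g = Equivalence.from T-∨ ∘ Sum.map f g ∘ Equivalence.to T-∨

    ⊔-⊓-lub : ∀ x y z c {R} → x ⊓ c ≤ R → y ≤ R → z ≤ R → (x ⊔ y ⊔ z) ⊓ c ≤ R
    ⊔-⊓-lub x y z c x⊓c≤R y≤R z≤R = begin
      (x ⊔ y ⊔ z) ⊓ c                ≡⟨ ⊓-distribʳ-⊔ c (x ⊔ y) z ⟩
      (x ⊔ y) ⊓ c ⊔ z ⊓ c            ≡⟨ cong (_⊔ z ⊓ c) (⊓-distribʳ-⊔ c x y) ⟩
      x ⊓ c ⊔ y ⊓ c ⊔ z ⊓ c          ≤⟨ ⊔-lub (⊔-lub x⊓c≤R (≤-trans (m⊓n≤m y c) y≤R))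
                                                (≤-trans (m⊓n≤m z c) z≤R) ⟩
      _                              ∎
      where open ≤-Reasoning

  ∂-<ᵇ : ∀ {n} b (g : Multiset n → ℕ) v → ∂ (λ w → b <ᵇ g w) v ≡ (b <ᵇ maxAbove g v)
  ∂-<ᵇ b g []      = refl
  ∂-<ᵇ b g (a ∷ v) = trans (cong ((b <ᵇ g (suc a ∷ v)) ∨_) (∂-<ᵇ b (λ w → g (a ∷ w)) v))
                           (<ᵇ-⊔ b (g (suc a ∷ v)) _)

  ∑-antidiag-∂ : ∀ M (h : ℕ → ℕ → Bool) →
    ∑-antidiag (suc M) (λ a b → 𝟙 (h a b)) ⊓ suc M ≤ ∑-antidiag M (λ a b → 𝟙 (h (suc a) b ∨ h a (suc b)))
  ∑-antidiag-∂ zero h with h 0 1 | h 1 0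
  ... | true  | true  = ≤-refl
  ... | true  | false = ≤-refl
  ... | false | true  = ≤-refl
  ... | false | false = z≤n
  ∑-antidiag-∂ (suc M) h = step (h 1 (suc M)) (h 0 (suc (suc M)))
    (∑-antidiag-𝟙≤ M (λ a → h (suc (suc a)))) (∑-antidiag-∂ M (λ a → h (suc a)))
    where
      step : ∀ p q {N Q} → N ≤ suc M → (𝟙 p + N) ⊓ suc M ≤ Q →
             (𝟙 q + (𝟙 p + N)) ⊓ suc (suc M) ≤ 𝟙 (p ∨ q) + Q
      step true  true  _   ih = s≤s ih
      step false true  _   ih = s≤s ih
      step true  false _   ih = s≤s (≤-trans (⊓-monoˡ-≤ (suc M) (n≤1+n _)) ih)
      step false false N≤ ih =
        ≤-trans (≤-reflexive (trans (m≤n⇒m⊓n≡m (m≤n⇒m≤1+n N≤)) (sym (m≤n⇒m⊓n≡m N≤)))) ih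

  compress-mono : ∀ {m} (k : Fin m) {X Y : Family (suc m)} → (∀ v → T (X v) → T (Y v)) →
                  ∀ v → T (compress k X v) → T (compress k Y v)
  compress-mono zero    X⊆Y (a ∷ b ∷ v) =
    <ᵇ-mono b (∑-antidiag-mono (a + b) λ x y _ → 𝟙-mono (X⊆Y (x ∷ y ∷ v)))
  compress-mono (suc k) X⊆Y (a ∷ c ∷ w) =
    compress-mono k (λ { (a′ ∷ w′) → X⊆Y (a′ ∷ c ∷ w′) }) (a ∷ w)

  ∂∪compress₀ : ∀ {m} (X Y : Family (2 + m)) a b v →
    (∂ (compress zero X) ∪ compress zero Y) (a ∷ b ∷ v) ≡
    (b <ᵇ lineCount X (suc (a + b)) v ⊔ maxAbove (lineCount X (a + b)) v ⊔ lineCount Y (a + b) v)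
  ∂∪compress₀ X Y a b v rewrite +-suc a b = begin
    ((b <ᵇ N₊) ∨ ((suc b <ᵇ N₊) ∨ ∂ (λ w → b <ᵇ lineCount X (a + b) w) v)) ∨ (b <ᵇ NY)
      ≡⟨ cong (λ p → ((b <ᵇ N₊) ∨ ((suc b <ᵇ N₊) ∨ p)) ∨ (b <ᵇ NY)) (∂-<ᵇ b (lineCount X (a + b)) v) ⟩
    ((b <ᵇ N₊) ∨ ((suc b <ᵇ N₊) ∨ (b <ᵇ S))) ∨ (b <ᵇ NY)
      ≡⟨ cong (_∨ (b <ᵇ NY)) (trans (sym (∨-assoc (b <ᵇ N₊) _ _))
                                     (cong (_∨ (b <ᵇ S)) (<ᵇ-∨-suc b N₊))) ⟩
    ((b <ᵇ N₊) ∨ (b <ᵇ S)) ∨ (b <ᵇ NY)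
      ≡⟨ trans (cong (_∨ (b <ᵇ NY)) (<ᵇ-⊔ b N₊ S)) (<ᵇ-⊔ b (N₊ ⊔ S) NY) ⟩
    (b <ᵇ N₊ ⊔ S ⊔ NY) ∎
    where
      open ≡-Reasoning
      N₊ = lineCount X (suc (a + b)) v
      S  = maxAbove (lineCount X (a + b)) v
      NY = lineCount Y (a + b) v

  ∂∪-fibre₁ : ∀ {m} (F G : Family (2 + m)) c a w →
    (∂ F ∪ G) (a ∷ c ∷ w) ≡ (∂ (fibre₁ F c) ∪ (fibre₁ F (suc c) ∪ fibre₁ G c)) (a ∷ w)
  ∂∪-fibre₁ F G c a w =
    solve 4 (λ p q r s → (p :+ (q :+ r)) :+ s := (p :+ r) :+ (q :+ s)) refl
      (F (suc a ∷ c ∷ w)) (F (a ∷ suc c ∷ w)) (∂ (λ w′ → F (a ∷ c ∷ w′)) w) (G (a ∷ c ∷ w))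
    where open ∨-∧-Solver

  lineCount-∂∪compress₀ : ∀ {m} (X Y : Family (2 + m)) M v →
    lineCount (∂ (compress zero X) ∪ compress zero Y) M v ≤ lineCount (∂ X ∪ Y) M v
  lineCount-∂∪compress₀ X Y M v = begin
    lineCount (∂ (compress zero X) ∪ compress zero Y) M v
      ≡⟨ ∑-antidiag-cong M (λ a b a+b≡M → cong 𝟙 (trans (∂∪compress₀ X Y a b v)
           (cong (λ M′ → b <ᵇ lineCount X (suc M′) v ⊔ maxAbove (lineCount X M′) v ⊔ lineCount Y M′ v) a+b≡M))) ⟩
    ∑-antidiag M (λ _ b → 𝟙 (b <ᵇ N₊ ⊔ S ⊔ NY))
      ≡⟨ ∑-antidiag-<ᵇ M (N₊ ⊔ S ⊔ NY) ⟩
    (N₊ ⊔ S ⊔ NY) ⊓ suc M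
      ≤⟨ ⊔-⊓-lub N₊ S NY (suc M)
           (≤-trans (∑-antidiag-∂ M (λ a b → X (a ∷ b ∷ v))) (∑-antidiag-mono M λ a b _ → 𝟙-mono (within a b)))
           (maxAbove-lub (lineCount X M) v λ j → ∑-antidiag-mono M λ a b _ → 𝟙-mono (above j a b))
           (∑-antidiag-mono M λ a b _ → 𝟙-mono (T-∨ʳ (∂ X (a ∷ b ∷ v)))) ⟩
    lineCount (∂ X ∪ Y) M v ∎
    where
      open ≤-Reasoning
      N₊ = lineCount X (suc M) v
      S  = maxAbove (lineCount X M) v
      NY = lineCount Y M v
      within : ∀ a b → T (X (suc a ∷ b ∷ v) ∨ X (a ∷ suc b ∷ v)) → T ((∂ X ∪ Y) (a ∷ b ∷ v))
      within a b = T-∨ˡ (Y (a ∷ b ∷ v))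
                 ∘ Sum.[ ∂-complete X (a ∷ b ∷ v) zero , ∂-complete X (a ∷ b ∷ v) (suc zero) ]
                 ∘ Equivalence.to T-∨
      above : ∀ j a b → T (X (a ∷ b ∷ (v [ j ]%= suc))) → T ((∂ X ∪ Y) (a ∷ b ∷ v))
      above j a b = T-∨ˡ (Y (a ∷ b ∷ v)) ∘ ∂-complete X (a ∷ b ∷ v) (suc (suc j))

  -- The extra family Y makes the induction on k go through: inside a fibre of coordinate 1 the
  -- shadow also receives the neighbouring fibre.
  count-∂∪compress : ∀ {m} (k : Fin m) (X Y : Family (suc m)) t →
    count t (∂ (compress k X) ∪ compress k Y) ≤ count t (∂ X ∪ Y)
  count-∂∪compress {suc m} zero X Y t = begin
    count t (∂ (compress zero X) ∪ compress zero Y)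
      ≡⟨ count-byLines t (∂ (compress zero X) ∪ compress zero Y) ⟩
    ∑-level t (λ u → lineCount (∂ (compress zero X) ∪ compress zero Y) (head u) (tail u))
      ≤⟨ ∑-level-mono t (λ u _ → lineCount-∂∪compress₀ X Y (head u) (tail u)) ⟩
    ∑-level t (λ u → lineCount (∂ X ∪ Y) (head u) (tail u))
      ≡⟨ count-byLines t (∂ X ∪ Y) ⟨
    count t (∂ X ∪ Y) ∎
    where open ≤-Reasoning
  count-∂∪compress {suc m} (suc k) X Y t = begin
    count t (∂ (compress (suc k) X) ∪ compress (suc k) Y)
      ≡⟨ count-byFibres₁ t (∂ (compress (suc k) X) ∪ compress (suc k) Y) ⟩
    ∑-antidiag t (λ c r → count r (fibre₁ (∂ (compress (suc k) X) ∪ compress (suc k) Y) c))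
      ≤⟨ ∑-antidiag-mono t (λ c r _ → fibre c r) ⟩
    ∑-antidiag t (λ c r → count r (fibre₁ (∂ X ∪ Y) c))
      ≡⟨ count-byFibres₁ t (∂ X ∪ Y) ⟨
    count t (∂ X ∪ Y) ∎
    where
      open ≤-Reasoning
      fibre : ∀ c r → count r (fibre₁ (∂ (compress (suc k) X) ∪ compress (suc k) Y) c)
                    ≤ count r (fibre₁ (∂ X ∪ Y) c)
      fibre c r = begin
        count r (fibre₁ (∂ (compress (suc k) X) ∪ compress (suc k) Y) c)
          ≤⟨ count-mono r (fibre₁ (∂ (compress (suc k) X) ∪ compress (suc k) Y) c)
                          (∂ (compress k (fibre₁ X c)) ∪ compress k (fibre₁ X (suc c) ∪ fibre₁ Y c))
               (λ { (a ∷ w) _ → T-∨-map id (compress-∪ (a ∷ w))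
                                ∘ subst T (∂∪-fibre₁ (compress (suc k) X) (compress (suc k) Y) c a w) }) ⟩
        count r (∂ (compress k (fibre₁ X c)) ∪ compress k (fibre₁ X (suc c) ∪ fibre₁ Y c))
          ≤⟨ count-∂∪compress k (fibre₁ X c) (fibre₁ X (suc c) ∪ fibre₁ Y c) r ⟩
        count r (∂ (fibre₁ X c) ∪ (fibre₁ X (suc c) ∪ fibre₁ Y c))
          ≡⟨ count-cong r (fibre₁ (∂ X ∪ Y) c) (∂ (fibre₁ X c) ∪ (fibre₁ X (suc c) ∪ fibre₁ Y c))
               (λ { (a ∷ w) _ → ∂∪-fibre₁ X Y c a w }) ⟨
        count r (fibre₁ (∂ X ∪ Y) c) ∎
        where
          X₊ = fibre₁ X (suc c)
          Y₀ = fibre₁ Y c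
          compress-∪ : ∀ u → T ((compress k X₊ ∪ compress k Y₀) u) → T (compress k (X₊ ∪ Y₀) u)
          compress-∪ u = Sum.[ compress-mono k (λ v → T-∨ˡ (Y₀ v)) u
                             , compress-mono k (λ v → T-∨ʳ (X₊ v)) u ] ∘ Equivalence.to T-∨

  count-∂-compress : ∀ {m} (k : Fin m) (X : Family (suc m)) t → count t (∂ (compress k X)) ≤ count t (∂ X)
  count-∂-compress k X t = begin
    count t (∂ (compress k X))
      ≤⟨ count-mono t _ (∂ (compress k X) ∪ compress k ∅) (λ v _ → T-∨ˡ (compress k ∅ v)) ⟩
    count t (∂ (compress k X) ∪ compress k ∅)
      ≤⟨ count-∂∪compress k X ∅ t ⟩
    count t (∂ X ∪ ∅)
      ≤⟨ count-mono t (∂ X ∪ ∅) (∂ X) (λ v _ → Sum.[ id , ⊥-elim ] ∘ Equivalence.to T-∨) ⟩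
    count t (∂ X) ∎
    where open ≤-Reasoning

  compressAll : ∀ {m} → List (Fin m) → Family (suc m) → Family (suc m)
  compressAll []       F = F
  compressAll (k ∷ ks) F = compressAll ks (compress k F)

  count-compressAll : ∀ {m} (ks : List (Fin m)) F t → count t (compressAll ks F) ≡ count t F
  count-compressAll []       F t = refl
  count-compressAll (k ∷ ks) F t = trans (count-compressAll ks (compress k F) t) (count-compress k F t)

  count-∂-compressAll : ∀ {m} (ks : List (Fin m)) F t → count t (∂ (compressAll ks F)) ≤ count t (∂ F)
  count-∂-compressAll []       F t = ≤-refl
  count-∂-compressAll (k ∷ ks) F t = ≤-trans (count-∂-compressAll ks (compress k F) t) (count-∂-compress k F t)

  compressAll-compressed : ∀ {m} (ks : List (Fin m)) F j → j ∈ ks ⊎ Compressed j F →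
                           Compressed j (compressAll ks F)
  compressAll-compressed []       F j (inj₂ F-comp)     = F-comp
  compressAll-compressed (k ∷ ks) F j (inj₁ (here refl)) =
    compressAll-compressed ks (compress k F) j (inj₂ (compress-compressed j F))
  compressAll-compressed (k ∷ ks) F j (inj₁ (there j∈ks)) =
    compressAll-compressed ks (compress k F) j (inj₁ j∈ks)
  compressAll-compressed (k ∷ ks) F j (inj₂ F-comp)     =
    compressAll-compressed ks (compress k F) j (inj₂ (compress-preserves-compressed j k F F-comp))

  stabilise : ∀ {m} → Family (suc m) → Family (suc m)
  stabilise {m} = compressAll (allFin m)

  stabilise-stable : ∀ {m} (F : Family (suc m)) → Stable (stabilise F)
  stabilise-stable {m} F j = compressAll-compressed (allFin m) F j (inj₁ (∈-allFin j))

  count-stabilise : ∀ {m} (F : Family (suc m)) t → count t (stabilise F) ≡ count t F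
  count-stabilise {m} = count-compressAll (allFin m)

  count-∂-stabilise : ∀ {m} (F : Family (suc m)) t → count t (∂ (stabilise F)) ≤ count t (∂ F)
  count-∂-stabilise {m} = count-∂-compressAll (allFin m)

  -- Stable families

  deletion₀ : ∀ {m} → Family (suc m) → Family m
  deletion₀ F w = F (0 ∷ w)

  link₀ : ∀ {m} → Family (suc m) → Family (suc m)
  link₀ F v = F (v [ zero ]%= suc)

  count-split : ∀ {m} (F : Family (suc m)) s → count (suc s) F ≡ count (suc s) (deletion₀ F) + count s (link₀ F)
  count-split F s = refl

  link₀-stable : ∀ {m} (F : Family (suc m)) → Stable F → Stable (link₀ F)
  link₀-stable F F-stable j (a ∷ w) = F-stable j (suc a ∷ w)

  count-∂-stable : ∀ {m} (F : Family (suc m)) → Stable F → ∀ s → count s (∂ F) ≡ count s (link₀ F)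
  count-∂-stable F F-stable s = count-⇔ s (∂ F) (link₀ F) λ v _ → mk⇔ (∂⇒link₀ v) (∂-complete F v zero)
    where
      ∂⇒link₀ : ∀ v → T (∂ F v) → T (link₀ F v)
      ∂⇒link₀ v v∈∂F with ∂-sound F v v∈∂F
      ... | zero  , v+0∈F = v+0∈F
      ... | suc j , v+j∈F = F-stable j v v+j∈F

  ∂-deletion₀⊆deletion₀-link₀ : ∀ {m} (F : Family (2 + m)) → Stable F →
                                ∀ w → T (∂ (deletion₀ F) w) → T (deletion₀ (link₀ F) w)
  ∂-deletion₀⊆deletion₀-link₀ F F-stable w w∈∂F₀ with ∂-sound (deletion₀ F) w w∈∂F₀
  ... | j , w+j∈F₀ = F-stable j (0 ∷ w) w+j∈F₀

  link₀-nonempty : ∀ {m} (F : Family (suc m)) → Stable F →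
                   ∀ s → 1 ≤ count (suc s) F → 1 ≤ count s (link₀ F)
  link₀-nonempty F F-stable s nonempty =
    subst (1 ≤_) (count-∂-stable F F-stable s) (∂-nonempty s F nonempty)

  -- Families given by lists

  _≟ₘ_ : ∀ {n} → DecidableEquality (Multiset n)
  _≟ₘ_ = ≡-dec _≟_

  -- does rather than ⌊_⌋, so that memberOf (x ∷ L) v computes to does (v ≟ₘ x) ∨ memberOf L v.
  memberOf : ∀ {n} → List (Multiset n) → Family n
  memberOf L v = does (any? (v ≟ₘ_) L)

  private
    does-sound : ∀ {A : Set} (d : Dec A) → T (does d) → A
    does-sound (true because [a]) _ = invert [a]

    does-complete : ∀ {A : Set} (d : Dec A) → A → T (does d)
    does-complete (true  because _)    _ = _
    does-complete (false because [¬a]) a = invert [¬a] a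

  memberOf-sound : ∀ {n} (L : List (Multiset n)) v → T (memberOf L v) → v ∈ L
  memberOf-sound L v = does-sound (any? (v ≟ₘ_) L)

  memberOf-complete : ∀ {n} (L : List (Multiset n)) v → v ∈ L → T (memberOf L v)
  memberOf-complete L v = does-complete (any? (v ≟ₘ_) L)

  private
    𝟙-∨-disjoint : ∀ p q → (T p → T q → ⊥) → 𝟙 (p ∨ q) ≡ 𝟙 p + 𝟙 q
    𝟙-∨-disjoint true  true  disj = ⊥-elim (disj _ _)
    𝟙-∨-disjoint true  false disj = refl
    𝟙-∨-disjoint false q     disj = refl

  count-singleton : ∀ {n} (x : Multiset n) → count (size x) (λ v → does (v ≟ₘ x)) ≡ 1
  count-singleton x = trans (∑-level-point _ x λ v v≢x → cong 𝟙 (dec-false (v ≟ₘ x) v≢x))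
                    (cong 𝟙 (dec-true (x ≟ₘ x) refl))

  count-memberOf : ∀ {n} t (L : List (Multiset n)) → Unique L → All (λ v → size v ≡ t) L →
                   count t (memberOf L) ≡ length L
  count-memberOf {n} t []      []            []            = ∑-level-zero {n} t
  count-memberOf t (x ∷ L) (x∉L ∷ L-uniq) (refl ∷ L-lvl) = begin
    count t (memberOf (x ∷ L))
      ≡⟨ ∑-level-cong t (λ v _ → 𝟙-∨-disjoint (does (v ≟ₘ x)) (memberOf L v) (disjoint v)) ⟩
    ∑-level t (λ v → 𝟙 (does (v ≟ₘ x)) + 𝟙 (memberOf L v))
      ≡⟨ ∑-level-+ t (λ v → 𝟙 (does (v ≟ₘ x))) (λ v → 𝟙 (memberOf L v)) ⟩
    count t (λ v → does (v ≟ₘ x)) + count t (memberOf L)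
      ≡⟨ cong₂ _+_ (count-singleton x) (count-memberOf t L L-uniq L-lvl) ⟩
    suc (length L) ∎
    where
      open ≡-Reasoning
      disjoint : ∀ v → T (does (v ≟ₘ x)) → T (memberOf L v) → ⊥
      disjoint v v≡x v∈L with does-sound (v ≟ₘ x) v≡x
      ... | refl = All.lookup x∉L (memberOf-sound L v v∈L) refl

  size-mono-⊆ₘ : ∀ {n} {C A : Multiset n} → C ⊆ₘ A → size C ≤ size A
  size-mono-⊆ₘ []            = z≤n
  size-mono-⊆ₘ (c≤a ∷ C⊆A) = +-mono-≤ c≤a (size-mono-⊆ₘ C⊆A)

  ⊆ₘ∧size≡⇒≡ : ∀ {n} {C A : Multiset n} → C ⊆ₘ A → size C ≡ size A → C ≡ A
  ⊆ₘ∧size≡⇒≡ []                                   _     = refl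
  ⊆ₘ∧size≡⇒≡ {C = c ∷ C} {a ∷ A} (c≤a ∷ C⊆A) c+C≡a+A = cong₂ _∷_ c≡a (⊆ₘ∧size≡⇒≡ C⊆A C≡A)
    where
      a≤c : a ≤ c
      a≤c = +-cancelʳ-≤ (size C) a c
              (≤-trans (+-monoʳ-≤ a (size-mono-⊆ₘ C⊆A)) (≤-reflexive (sym c+C≡a+A)))
      c≡a : c ≡ a
      c≡a = ≤-antisym c≤a a≤c
      C≡A : size C ≡ size A
      C≡A = +-cancelˡ-≡ a _ _ (trans (cong (_+ size C) (sym c≡a)) c+C≡a+A)

  ⊆ₘ∧size≡suc⇒[]%=suc : ∀ {n} {C A : Multiset n} → C ⊆ₘ A → size A ≡ suc (size C) →
                        ∃[ j ] (A ≡ C [ j ]%= suc)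
  ⊆ₘ∧size≡suc⇒[]%=suc {C = c ∷ C} {a ∷ A} (c≤a ∷ C⊆A) a+A≡1+c+C with a ≟ c
  ... | yes refl with ⊆ₘ∧size≡suc⇒[]%=suc C⊆A (+-cancelˡ-≡ a _ _ (trans a+A≡1+c+C (sym (+-suc a (size C)))))
  ...   | j , A≡C+j = suc j , cong (a ∷_) A≡C+j
  ⊆ₘ∧size≡suc⇒[]%=suc {C = c ∷ C} {a ∷ A} (c≤a ∷ C⊆A) a+A≡1+c+C | no a≢c =
    zero , cong₂ _∷_ a≡1+c (sym (⊆ₘ∧size≡⇒≡ C⊆A (sym (+-cancelˡ-≡ a _ _ a+A≡a+C))))
    where
      a≤1+c : a ≤ suc c
      a≤1+c = +-cancelʳ-≤ (size C) a (suc c)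
                (≤-trans (+-monoʳ-≤ a (size-mono-⊆ₘ C⊆A)) (≤-reflexive a+A≡1+c+C))
      a≡1+c : a ≡ suc c
      a≡1+c = ≤-antisym a≤1+c (≤∧≢⇒< c≤a (a≢c ∘ sym))
      a+A≡a+C : a + size A ≡ a + size C
      a+A≡a+C = trans a+A≡1+c+C (cong (_+ size C) (sym a≡1+c))

  ⊆ₘ-[]%=suc : ∀ {n} (C : Multiset n) j → C ⊆ₘ (C [ j ]%= suc)
  ⊆ₘ-[]%=suc (c ∷ C) zero    = n≤1+n c ∷ Pointwise.refl ≤-refl
  ⊆ₘ-[]%=suc (c ∷ C) (suc j) = ≤-refl ∷ ⊆ₘ-[]%=suc C j

  ∂-memberOf⇔InShadow : ∀ {n} s (𝓐 : List (Multiset n)) → All (InM (suc s)) 𝓐 →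
                        ∀ C → size C ≡ s → T (∂ (memberOf 𝓐) C) ⇔ InShadow (suc s) 𝓐 C
  ∂-memberOf⇔InShadow s 𝓐 𝓐-level C ∣C∣≡s = mk⇔ to from
    where
      to : T (∂ (memberOf 𝓐) C) → InShadow (suc s) 𝓐 C
      to C∈∂𝓐 with ∂-sound (memberOf 𝓐) C C∈∂𝓐
      ... | j , C+j∈𝓐 = ∣C∣≡s , C [ j ]%= suc , memberOf-sound 𝓐 _ C+j∈𝓐 , ⊆ₘ-[]%=suc C j
      from : InShadow (suc s) 𝓐 C → T (∂ (memberOf 𝓐) C)
      from (_ , A , A∈𝓐 , C⊆A)
        with ⊆ₘ∧size≡suc⇒[]%=suc C⊆A (trans (All.lookup 𝓐-level A∈𝓐) (cong suc (sym ∣C∣≡s)))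
      ... | j , refl = ∂-complete (memberOf 𝓐) C j (memberOf-complete 𝓐 _ A∈𝓐)

open MultichooseProperties
open Families

open import Data.Nat.Base as ℕ using (ℕ; zero; suc; _≥_; _∸_)
open import Data.Rational.Base using (ℚ; 0ℚ; 1ℚ; _≤_; _<_; _+_; _-_; -_)
open import Data.Rational.Properties
open import Data.Bool.Base using (T)
open import Data.List.Base using (List; length)
open import Data.List.Membership.Propositional using (_∈_)
open import Data.List.Relation.Unary.All as All using (All)
open import Data.List.Relation.Unary.Unique.Propositional using (Unique)
open import Data.Product.Base using (∃-syntax; _,_; proj₁)
open import Function.Base using (_∘_)
open import Function.Bundles using (_⇔_; mk⇔; Equivalence)
open import Relation.Nullary using (yes; no; contradiction)
open import Relation.Binary.PropositionalEquality using (_≡_; refl; sym; trans; cong; subst)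

LovászBound : ℕ → Set
LovászBound n = ∀ s (F : Family n) → 1 ℕ.≤ count (suc s) F → ∀ y → 0ℚ ≤ y →
  multichoose y (suc s) ≤ ℕ→ℚ (count (suc s) F) → multichoose y s ≤ ℕ→ℚ (count s (∂ F))

private
  1<⇒0<-1 : ∀ {y} → 1ℚ < y → 0ℚ < y - 1ℚ
  1<⇒0<-1 {y} 1<y = subst (_< y - 1ℚ) (+-inverseʳ 1ℚ) (+-monoˡ-< (- 1ℚ) 1<y)

  ≤-of-+-≤ : ∀ {a b c d} → c < a → a + b ≤ c + d → b ≤ d
  ≤-of-+-≤ {a} {b} {c} {d} c<a a+b≤c+d with b ≤? d
  ... | yes b≤d = b≤d
  ... | no  b≰d = contradiction (<-≤-trans (+-mono-< c<a (≰⇒> b≰d)) a+b≤c+d) (<-irrefl refl)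

  ℕ→ℚ-count-split : ∀ {m} (F : Family (suc m)) s →
    ℕ→ℚ (count (suc s) F) ≡ ℕ→ℚ (count (suc s) (deletion₀ F)) + ℕ→ℚ (count s (link₀ F))
  ℕ→ℚ-count-split F s =
    trans (cong ℕ→ℚ (count-split F s)) (ℕ→ℚ-+ (count (suc s) (deletion₀ F)) (count s (link₀ F)))

stable-link₀-bound : ∀ {m} → LovászBound m →
  ∀ s (G : Family (suc m)) → Stable G → 1 ℕ.≤ count (suc s) G →
  ∀ y → 1ℚ < y → multichoose (y - 1ℚ) (suc s) ≤ ℕ→ℚ (count (suc s) (deletion₀ G)) →
  multichoose y s ≤ ℕ→ℚ (count s (link₀ G))
stable-link₀-bound bound zero G G-stable G-nonempty y 1<y _ =
  ℕ→ℚ-mono-≤ (link₀-nonempty G G-stable 0 G-nonempty)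
stable-link₀-bound {m} bound (suc r) G G-stable G-nonempty y 1<y G₀-large
  with ℕ→ℚ-cancel-< {0} {count (suc (suc r)) (deletion₀ G)}
         (<-≤-trans (multichoose-pos (suc (suc r)) (1<⇒0<-1 1<y)) G₀-large)
stable-link₀-bound {zero}  bound (suc r) G G-stable G-nonempty y 1<y G₀-large | ()
stable-link₀-bound {suc m} bound (suc r) G G-stable G-nonempty y 1<y G₀-large | G₀-nonempty = begin
  multichoose y (suc r)                                               ≡⟨ multichoose-pascal y r ⟩
  multichoose (y - 1ℚ) (suc r) + multichoose y r                      ≤⟨ +-mono-≤ G₁₀-large G₁₁-large ⟩
  ℕ→ℚ (count (suc r) (deletion₀ G₁)) + ℕ→ℚ (count r (link₀ G₁))       ≡⟨ ℕ→ℚ-count-split G₁ r ⟨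
  ℕ→ℚ (count (suc r) G₁)                                              ∎
  where
    open ≤-Reasoning
    G₁ = link₀ G
    G₁₀-large : multichoose (y - 1ℚ) (suc r) ≤ ℕ→ℚ (count (suc r) (deletion₀ G₁))
    G₁₀-large = ≤-trans
      (bound (suc r) (deletion₀ G) G₀-nonempty (y - 1ℚ) (<⇒≤ (1<⇒0<-1 1<y)) G₀-large)
      (ℕ→ℚ-mono-≤ (count-mono (suc r) _ _ λ w _ → ∂-deletion₀⊆deletion₀-link₀ G G-stable w))
    G₁₁-large : multichoose y r ≤ ℕ→ℚ (count r (link₀ G₁))
    G₁₁-large = stable-link₀-bound bound r G₁ (link₀-stable G G-stable)
      (link₀-nonempty G G-stable (suc r) G-nonempty) y 1<y G₁₀-large

lovász : ∀ n → LovászBound n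
lovász zero    s F () y 0≤y F-large
lovász (suc m) s F F-nonempty y 0≤y F-large =
  ≤-trans link₀-large (ℕ→ℚ-mono-≤ link₀-G≤∂F)
  where
    G = stabilise F
    G-stable = stabilise-stable F
    G-nonempty : 1 ℕ.≤ count (suc s) G
    G-nonempty = subst (1 ℕ.≤_) (sym (count-stabilise F (suc s))) F-nonempty
    link₀-G≤∂F : count s (link₀ G) ℕ.≤ count s (∂ F)
    link₀-G≤∂F = subst (ℕ._≤ count s (∂ F)) (count-∂-stable G G-stable s) (count-∂-stabilise F s)
    link₀-large : multichoose y s ≤ ℕ→ℚ (count s (link₀ G))
    link₀-large with y ≤? 1ℚ
    ... | yes y≤1 = ≤-trans (multichoose≤1 s 0≤y y≤1) (ℕ→ℚ-mono-≤ (link₀-nonempty G G-stable s G-nonempty))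
    ... | no  y≰1 with multichoose (y - 1ℚ) (suc s) ≤? ℕ→ℚ (count (suc s) (deletion₀ G))
    ...   | yes G₀-large = stable-link₀-bound (lovász m) s G G-stable G-nonempty y (≰⇒> y≰1) G₀-large
    ...   | no  G₀-small = ≤-of-+-≤ (≰⇒> G₀-small) (begin
      multichoose (y - 1ℚ) (suc s) + multichoose y s               ≡⟨ multichoose-pascal y s ⟨
      multichoose y (suc s)                                         ≤⟨ F-large ⟩
      ℕ→ℚ (count (suc s) F)                                         ≡⟨ cong ℕ→ℚ (count-stabilise F (suc s)) ⟨
      ℕ→ℚ (count (suc s) G)                                         ≡⟨ ℕ→ℚ-count-split G s ⟩
      ℕ→ℚ (count (suc s) (deletion₀ G)) + ℕ→ℚ (count s (link₀ G))  ∎)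
      where open ≤-Reasoning

theorem7 : (n t : ℕ) → n ≥ 1 → t ≥ 1 →
  (𝓐 : List (Multiset n)) → Unique 𝓐 → All (InM t) 𝓐 →
  (∃[ A ] (A ∈ 𝓐)) →
  (S : List (Multiset n)) → Unique S →
  (∀ C → C ∈ S ⇔ InShadow t 𝓐 C) →
  (y : ℚ) → 0ℚ ≤ y → multichoose y t ≤ ℕ→ℚ (length 𝓐) →
  multichoose y (t ∸ 1) ≤ ℕ→ℚ (length S)
theorem7 n zero    _ ()
theorem7 n (suc s) _ _ 𝓐 𝓐-unique 𝓐-level (A , A∈𝓐) S S-unique S⇔∂𝓐 y 0≤y 𝓐-large =
  subst (λ k → multichoose y s ≤ ℕ→ℚ k) count-∂𝓐≡∣S∣
    (lovász n s (memberOf 𝓐) 𝓐-nonempty y 0≤y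
      (subst (λ k → multichoose y (suc s) ≤ ℕ→ℚ k) (sym count-𝓐≡∣𝓐∣) 𝓐-large))
  where
    count-𝓐≡∣𝓐∣ : count (suc s) (memberOf 𝓐) ≡ length 𝓐
    count-𝓐≡∣𝓐∣ = count-memberOf (suc s) 𝓐 𝓐-unique 𝓐-level
    𝓐-nonempty : 1 ℕ.≤ count (suc s) (memberOf 𝓐)
    𝓐-nonempty = subst (λ t → 1 ℕ.≤ count t (memberOf 𝓐)) (All.lookup 𝓐-level A∈𝓐)
                   (count-member (memberOf 𝓐) A (memberOf-complete 𝓐 A A∈𝓐))
    S-level : All (λ C → size C ≡ s) S
    S-level = All.tabulate λ {C} C∈S → proj₁ (Equivalence.to (S⇔∂𝓐 C) C∈S)
    ∂𝓐⇔S : ∀ C → size C ≡ s → T (∂ (memberOf 𝓐) C) ⇔ T (memberOf S C)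
    ∂𝓐⇔S C ∣C∣≡s = let ∂⇔ = ∂-memberOf⇔InShadow s 𝓐 𝓐-level C ∣C∣≡s in mk⇔
      (memberOf-complete S C ∘ Equivalence.from (S⇔∂𝓐 C) ∘ Equivalence.to ∂⇔)
      (Equivalence.from ∂⇔ ∘ Equivalence.to (S⇔∂𝓐 C) ∘ memberOf-sound S C)
    count-∂𝓐≡∣S∣ : count s (∂ (memberOf 𝓐)) ≡ length S
    count-∂𝓐≡∣S∣ = trans (count-⇔ s _ (memberOf S) ∂𝓐⇔S) (count-memberOf s S S-unique S-level)
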